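{- Fix integers $r\ge 1$ and $s\ge 3$. For each $j\in[s-1]$ let $x_j=(0,\dots,0,\omega_r,0,\dots,0,\omega_r)\in\mathbb{R}^{rs}$, where the first $\omega_r$ is in the $j$-th block and the second in the last ($s$-th) block. Then: (1) every element of $\mathsf{LR}_r^s$ can be written uniquely as $z+\sum_{j=1}^{s-1}a_jx_j$ with $z\in\mathsf{C}_{SL_r}^s$ and $a_j\in\mathbb{R}_{\ge 0}$, and every such sum lies in $\mathsf{LR}_r^s$; i.e. $\mathsf{LR}_r^s=\mathsf{C}_{SL_r}^s\oplus\bigoplus_{j=1}^{s-1}\mathbb{R}_{\ge0}x_j$ (internal direct sum); (2) $\mathsf{C}_r^s=\mathsf{LR}_r^s+\bigoplus_{j=1}^{s-1}\mathbb{R}x_j$; (3) $\mathsf{EqC}_r^s=\mathsf{EqLR}_r^s+\bigoplus_{j=1}^{s-1}\mathbb{R}x_j$.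
   Context: Points of $\mathbb{R}^{rs}$ are written $(\lambda^1,\dots,\lambda^{s-1},\nu)$ with $\lambda^j=(\lambda^j_1,\dots,\lambda^j_r)\in\mathbb{R}^r$ and $\nu\in\mathbb{R}^r$; $|\lambda|=\lambda_1+\dots+\lambda_r$; for $\lambda,\mu\in\mathbb{R}^r$, $\lambda\subseteq\mu$ means $\lambda_i\le\mu_i$ for all $i$. For $j\in[r]$, $\omega_j=(1,\dots,1,0,\dots,0)\in\mathbb{R}^r$ with $j$ ones. For a $d$-element set $I=\{i_1<\dots<i_d\}$ of positive integers, $\tau(I)$ is the partition $(i_d-d\ge\dots\ge i_2-2\ge i_1-1)$. For $d$-element subsets $I_1,\dots,I_{s-1},K$, $c^{K}_{I_1,\dots,I_{s-1}}$ denotes the coefficient of the Schubert class $[X_{\tau(K)}]$ in the product $[X_{\tau(I_1)}]\cdots[X_{\tau(I_{s-1})}]$ in $H^*(\mathrm{Gr}(d,\mathbb{C}^n))$ for $n$ sufficiently large (a multi-factor Littlewood–Richardson coefficient, independent of $n$). Conditions on $(\lambda^1,\dots,\lambda^{s-1},\nu)$: (i) each $\lambda^j$ and $\nu$ is weakly decreasing; (ii) $\sum_{j=1}^{s-1}|\lambda^j|=|\nu|$; (ii') $\sum_{j=1}^{s-1}|\lambda^j|\ge|\nu|$; (iii) (Horn inequalities) for every $1\le d<r$ and all $d$-element subsets $I_1,\dots,I_{s-1},K$ of $[r]$ with $c^K_{I_1,\dots,I_{s-1}}=1$: $\sum_{j=1}^{s-1}\sum_{a\in I_j}\lambda^j_a\ge\sum_{k\in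 K}\nu_k$; (iv) $\lambda^j\subseteq\nu$ for all $j\in[s-1]$. Cones: $\mathsf{C}_r^s$ is the set satisfying (i),(ii),(iii) (equivalently, the eigenvalue tuples of $r\times r$ Hermitian matrices with $A_1+\dots+A_{s-1}=C$); $\mathsf{EqC}_r^s$ is the set satisfying (i),(ii'),(iii) (equivalently, eigenvalue tuples with $A_1+\dots+A_{s-1}-C$ positive semidefinite); $\mathsf{LR}_r^s=\{x\in\mathsf{C}_r^s:\lambda^j_r\ge0\ \forall j\in[s-1]\}$; $\mathsf{EqLR}_r^s=\{x\in\mathsf{EqC}_r^s:\lambda^j_r\ge0 \text{ and } \lambda^j\subseteq\nu\ \forall j\in[s-1]\}$; $\mathsf{C}_{SL_r}^s=\{x\in\mathsf{C}_r^s:\lambda^j_r=0\ \forall j\in[s-1]\}$. -}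

module Defs where

open import Level using (Level)
open import Data.Bool using (Bool; true; false; if_then_else_)
open import Data.Nat as ℕ using (ℕ; zero; suc)
open import Data.Fin as Fin using (Fin; toℕ)
open import Data.Vec as Vec using (Vec; []; _∷_; lookup; tabulate; replicate; zipWith; map; foldr; reverse; toList)
open import Data.List as List using (List; []; _∷_)
open import Data.Nat.ListAction using (sum)
open import Data.Product using (Σ; _×_; _,_)
open import Data.Empty using (⊥)
open import Relation.Nullary using (¬_; does)
open import Relation.Binary.PropositionalEquality using (_≡_)
open import Algebra.Structures using (IsCommutativeRing)
open import Relation.Binary.Structures using (IsTotalOrder)

record OrderedField (ℓ : Level) : Set (Level.suc ℓ) where
  infixl 7 _*_
  infixl 6 _+_
  infix 4 _≤_
  field
    Carrier : Set ℓ
    _+_ _*_ : Carrier → Carrier → Carrier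
    -_ : Carrier → Carrier
    0# 1# : Carrier
    _≤_ : Carrier → Carrier → Set ℓ
    isCommutativeRing : IsCommutativeRing _≡_ _+_ _*_ -_ 0# 1#
    isTotalOrder : IsTotalOrder _≡_ _≤_
    +-mono-≤ : ∀ {x y} z → x ≤ y → x + z ≤ y + z
    *-nonneg : ∀ {x y} → 0# ≤ x → 0# ≤ y → 0# ≤ x * y
    0≢1 : ¬ (0# ≡ 1#)
    inverse : ∀ x → ¬ (x ≡ 0#) → Σ Carrier (λ y → x * y ≡ 1#)

-- A d-element subset {i₁ < … < i_d} of [r], listed increasingly
-- (Fin r encodes [r] = {1,…,r} shifted by one).
StrictInc : ∀ {r d} → Vec (Fin r) d → Set
StrictInc {d = d} I = ∀ (i j : Fin d) → i Fin.< j → lookup I i Fin.< lookup I j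

-- τ(I) = (i_d - d ≥ … ≥ i₁ - 1), as a vector of length d.
-- (i_t - t = toℕ (I t) - toℕ t with 0-based Fin encodings.)
τ : ∀ {r d} → Vec (Fin r) d → Vec ℕ d
τ I = reverse (tabulate (λ t → toℕ (lookup I t) ℕ.∸ toℕ t))

IsPartition : ∀ {d} → Vec ℕ d → Set
IsPartition {d} μ = ∀ (i j : Fin d) → i Fin.≤ j → lookup μ j ℕ.≤ lookup μ i

prefixSum : ∀ {d} → Vec ℕ d → ℕ → ℕ
prefixSum v k = sum (List.take k (toList v))

col : ∀ {d e} → Vec (Vec ℕ e) d → Fin e → Vec ℕ d
col n k = map (λ row → lookup row k) n

-- A Littlewood–Richardson tableau of skew shape ν/λ and content μ
-- (all partitions with at most d parts), encoded by the matrix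
-- n, where  lookup (lookup n i) k  = number of entries (k+1) in row (i+1).
-- Rows are weakly increasing, so the tableau is determined by n.
record IsLRTableau {d} (λ' ν μ : Vec ℕ d) (n : Vec (Vec ℕ d) d) : Set where
  field
    shape   : ∀ (i : Fin d) → lookup λ' i ℕ.+ Vec.sum (lookup n i) ≡ lookup ν i
    content : ∀ (k : Fin d) → Vec.sum (col n k) ≡ lookup μ k
    column-strict : ∀ (i i' : Fin d) → toℕ i ≡ suc (toℕ i') → ∀ (k : Fin d) →
      lookup λ' i ℕ.+ prefixSum (lookup n i) (suc (toℕ k))
        ℕ.≤ lookup λ' i' ℕ.+ prefixSum (lookup n i') (toℕ k)
    lattice : ∀ (i k k' : Fin d) → toℕ k' ≡ suc (toℕ k) →
      prefixSum (col n k') (suc (toℕ i)) ℕ.≤ prefixSum (col n k) (toℕ i)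

-- LR data for the product  s_{p₁} ⋯ s_{p_m}  starting from the partition
-- 'start' and ending at 'target': a chain start ⊆ μ₁ ⊆ … ⊆ μ_m = target of
-- partitions with an LR tableau of shape μ_j/μ_{j-1} and content p_j.
ValidLRChain : ∀ {d} → Vec ℕ d → List (Vec ℕ d) → Vec ℕ d →
               List (Vec ℕ d × Vec (Vec ℕ d) d) → Set
ValidLRChain start [] target [] = start ≡ target
ValidLRChain start [] target (_ ∷ _) = ⊥
ValidLRChain start (p ∷ ps) target [] = ⊥
ValidLRChain start (p ∷ ps) target ((μ , n) ∷ rest) =
  IsPartition μ × IsLRTableau start μ p n × ValidLRChain μ ps target rest

-- c^K_{I₁,…,I_m} = number of LR chains from ∅ with contents τ(I₁),…,τ(I_m)
-- ending at τ(K)  (iterated Littlewood–Richardson rule).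
-- "c^K_{I₁,…,I_m} = 1" : there is exactly one such chain.
LRCoeffIsOne : ∀ {r d m} → Vec (Vec (Fin r) d) m → Vec (Fin r) d → Set
LRCoeffIsOne {d = d} Is K =
  Σ (List (Vec ℕ d × Vec (Vec ℕ d) d)) λ D →
    ValidLRChain (replicate d 0) (toList (map τ Is)) (τ K) D ×
    (∀ D' → ValidLRChain (replicate d 0) (toList (map τ Is)) (τ K) D' → D' ≡ D)

module Cones {ℓ} (F : OrderedField ℓ) where
  open OrderedField F

  sumF : ∀ {n} → Vec Carrier n → Carrier
  sumF = foldr _ _+_ 0#

  -- a point (λ¹,…,λ^m, ν) of F^{r(m+1)},  m = s - 1
  Point : ℕ → ℕ → Set ℓ
  Point m r = Vec (Vec Carrier r) m × Vec Carrier r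

  Decreasing : ∀ {r} → Vec Carrier r → Set ℓ
  Decreasing {r} v = ∀ (i j : Fin r) → i Fin.≤ j → lookup v j ≤ lookup v i

  LastEntry : ∀ {r} → (Carrier → Set ℓ) → Vec Carrier r → Set ℓ
  LastEntry {r} P v = ∀ (i : Fin r) → suc (toℕ i) ≡ r → P (lookup v i)

  sumOver : ∀ {r d} → Vec (Fin r) d → Vec Carrier r → Carrier
  sumOver I v = sumF (map (lookup v) I)

  CondI : ∀ {m r} → Point m r → Set ℓ
  CondI {m} (λs , ν) = (∀ (j : Fin m) → Decreasing (lookup λs j)) × Decreasing ν

  CondII : ∀ {m r} → Point m r → Set ℓ
  CondII (λs , ν) = sumF (map sumF λs) ≡ sumF ν

  CondII' : ∀ {m r} → Point m r → Set ℓ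
  CondII' (λs , ν) = sumF ν ≤ sumF (map sumF λs)

  Horn : ∀ {m r} → Point m r → Set ℓ
  Horn {m} {r} (λs , ν) =
    ∀ (d : ℕ) → 1 ℕ.≤ d → d ℕ.< r →
    ∀ (Is : Vec (Vec (Fin r) d) m) (K : Vec (Fin r) d) →
    (∀ (j : Fin m) → StrictInc (lookup Is j)) → StrictInc K →
    LRCoeffIsOne Is K →
    sumOver K ν ≤ sumF (zipWith sumOver Is λs)

  CondIV : ∀ {m r} → Point m r → Set ℓ
  CondIV {m} {r} (λs , ν) = ∀ (j : Fin m) (i : Fin r) → lookup (lookup λs j) i ≤ lookup ν i

  LastNonneg : ∀ {m r} → Point m r → Set ℓ
  LastNonneg {m} (λs , ν) = ∀ (j : Fin m) → LastEntry (λ x → 0# ≤ x) (lookup λs j)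

  LastZero : ∀ {m r} → Point m r → Set ℓ
  LastZero {m} (λs , ν) = ∀ (j : Fin m) → LastEntry (λ x → x ≡ 0#) (lookup λs j)

  C : ∀ {m r} → Point m r → Set ℓ
  C x = CondI x × CondII x × Horn x

  EqC : ∀ {m r} → Point m r → Set ℓ
  EqC x = CondI x × CondII' x × Horn x

  LR : ∀ {m r} → Point m r → Set ℓ
  LR x = C x × LastNonneg x

  EqLR : ∀ {m r} → Point m r → Set ℓ
  EqLR x = EqC x × LastNonneg x × CondIV x

  C-SL : ∀ {m r} → Point m r → Set ℓ
  C-SL x = C x × LastZero x

  _⊕_ : ∀ {m r} → Point m r → Point m r → Point m r
  (λs , ν) ⊕ (λs' , ν') = zipWith (zipWith _+_) λs λs' , zipWith _+_ ν ν'

  _·_ : ∀ {m r} → Carrier → Point m r → Point m r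
  a · (λs , ν) = map (map (a *_)) λs , map (a *_) ν

  zeroP : ∀ {m r} → Point m r
  zeroP {m} {r} = replicate m (replicate r 0#) , replicate r 0#

  ω : (r : ℕ) → Vec Carrier r
  ω r = replicate r 1#

  xgen : ∀ {m} r → Fin m → Point m r
  xgen {m} r j =
    tabulate (λ k → if does (k Fin.≟ j) then ω r else replicate r 0#) , ω r

  comb : ∀ {m} r → Vec Carrier m → Point m r
  comb {m} r a = foldr _ _⊕_ zeroP (tabulate (λ j → lookup a j · xgen r j))

  Nonneg : ∀ {m} → Vec Carrier m → Set ℓ
  Nonneg {m} a = ∀ (j : Fin m) → 0# ≤ lookup a j

-- Adding a·x_j to a point adds a to every part of λ^j and to every part of ν.
-- Such a shift preserves (i), and both sides of (ii), (ii') and of every Horn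
-- inequality for d-element sets grow by the same amount (r·a, resp. d·a), so C
-- and EqC are invariant under the lines ℝ x_j.  Shifting by minus the last parts
-- λ^j_r lands in C_SL, and the last parts of z + Σ a_j x_j with z ∈ C_SL are
-- exactly the a_j; this gives (1) and (2).  For (3), adding M·x_j for every j,
-- with M ≥ 0 large, makes the λ^j nonnegative while ν grows by (s-1)M ≥ 2M, one
-- M more than λ^j, which is enough for λ^j ⊆ ν.
module Submission where

open import Defs
open import Level using (Level)
open import Data.Vec using (Vec)
open import Data.Product using (Σ; _×_; _,_)
open import Relation.Binary.PropositionalEquality using (_≡_)

open import Algebra.Bundles using (CommutativeRing)
open import Data.Bool using (true; false; if_then_else_)
open import Data.Fin as Fin using (Fin; fromℕ)
open import Data.Fin.Properties using (toℕ-fromℕ; toℕ-injective)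
open import Data.Nat using (ℕ; zero; suc; s≤s)
open import Data.Nat.Properties using (suc-injective)
open import Data.Product using (proj₁; proj₂)
open import Data.Vec using ([]; _∷_; lookup; map; zipWith; replicate; tabulate; foldr)
open import Data.Vec.Properties
  using (lookup-map; lookup-zipWith; lookup-replicate; lookup∘tabulate; tabulate∘lookup; tabulate-∘; tabulate-cong;
         map-∘; map-cong; map-id)
open import Data.Vec.Relation.Binary.Pointwise.Extensional using (ext; Pointwise-≡⇒≡)
open import Function using (_∘_)
open import Relation.Binary.Bundles using (TotalOrder)
open import Relation.Binary.PropositionalEquality using (refl; sym; trans; cong; cong₂; subst; subst₂; module ≡-Reasoning)
open import Relation.Nullary using (does)
import Algebra.Construct.NaturalChoice.Max as Max
import Algebra.Properties.AbelianGroup as AbelianGroupProperties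
import Algebra.Properties.CommutativeMonoid.Mult as MultProperties
import Algebra.Properties.CommutativeSemigroup as CommutativeSemigroupProperties
import Relation.Binary.Reasoning.PartialOrder as PartialOrderReasoning

vec-ext : ∀ {a} {A : Set a} {n} {u v : Vec A n} → (∀ i → lookup u i ≡ lookup v i) → u ≡ v
vec-ext h = Pointwise-≡⇒≡ (ext h)

module Shifts {ℓ} (F : OrderedField ℓ) where
  open OrderedField F renaming (+-mono-≤ to +-monoˡ-≤)
  open Cones F

  private
    commutativeRing : CommutativeRing ℓ ℓ
    commutativeRing = record { isCommutativeRing = isCommutativeRing }

    totalOrder : TotalOrder ℓ ℓ ℓ
    totalOrder = record { isTotalOrder = isTotalOrder }

  open CommutativeRing commutativeRing
    using (+-assoc; +-comm; +-identityˡ; +-identityʳ; -‿inverseˡ; -‿inverseʳ; *-identityʳ; zeroʳ;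
           +-abelianGroup; +-commutativeMonoid; +-commutativeSemigroup)
  open TotalOrder totalOrder using (poset) renaming (refl to ≤-refl; trans to ≤-trans)
  open AbelianGroupProperties +-abelianGroup
    using (ε⁻¹≈ε; ⁻¹-∙-comm; ⁻¹-involutive; //-rightDividesˡ; //-rightDividesʳ)
  open CommutativeSemigroupProperties +-commutativeSemigroup using (interchange)
  open MultProperties +-commutativeMonoid using (×-distrib-+) renaming (_×_ to _×ₙ_)
  open Max totalOrder using (_⊔_; x≤x⊔y; x≤y⊔x; x≤y⇒x≤z⊔y)

  +-monoʳ-≤ : ∀ {x y} z → x ≤ y → z + x ≤ z + y
  +-monoʳ-≤ {x} {y} z x≤y = subst₂ _≤_ (+-comm x z) (+-comm y z) (+-monoˡ-≤ z x≤y)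

  +-mono-≤ : ∀ {x y u v} → x ≤ y → u ≤ v → x + u ≤ y + v
  +-mono-≤ {y = y} {u} x≤y u≤v = ≤-trans (+-monoˡ-≤ u x≤y) (+-monoʳ-≤ y u≤v)

  x≤x+y : ∀ x {y} → 0# ≤ y → x ≤ x + y
  x≤x+y x 0≤y = subst (_≤ x + _) (+-identityʳ x) (+-monoʳ-≤ x 0≤y)

  -x≤y⇒0≤x+y : ∀ {x y} → - x ≤ y → 0# ≤ x + y
  -x≤y⇒0≤x+y {x} {y} -x≤y = subst₂ _≤_ (-‿inverseˡ x) (+-comm y x) (+-monoˡ-≤ x -x≤y)

  x-y≤z⇒x≤z+y : ∀ {x y z} → x + - y ≤ z → x ≤ z + y
  x-y≤z⇒x≤z+y {x} {y} x-y≤z = subst (_≤ _) (//-rightDividesˡ y x) (+-monoˡ-≤ y x-y≤z)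

  ×-zeroʳ : ∀ n → n ×ₙ 0# ≡ 0#
  ×-zeroʳ zero    = refl
  ×-zeroʳ (suc n) = trans (+-identityˡ _) (×-zeroʳ n)

  upper-bound : ∀ {n} (f : Fin n → Carrier) → Σ Carrier λ M → 0# ≤ M × (∀ i → f i ≤ M)
  upper-bound {zero}  f = 0# , ≤-refl , λ ()
  upper-bound {suc n} f with upper-bound (f ∘ Fin.suc)
  ... | M , 0≤M , f≤M = f Fin.zero ⊔ M , x≤y⇒x≤z⊔y _ 0≤M , bound
    where
    bound : ∀ i → f i ≤ f Fin.zero ⊔ M
    bound Fin.zero    = x≤x⊔y _ _
    bound (Fin.suc i) = x≤y⇒x≤z⊔y _ (f≤M i)

  upper-bound₂ : ∀ {m n} (f : Fin m → Fin n → Carrier) → Σ Carrier λ M → 0# ≤ M × (∀ j i → f j i ≤ M)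
  upper-bound₂ f with upper-bound (λ j → proj₁ (upper-bound (f j)))
  ... | M , 0≤M , bounds≤M = M , 0≤M , λ j i → ≤-trans (proj₂ (proj₂ (upper-bound (f j))) i) (bounds≤M j)

  _+ᶜ_ : ∀ {n} → Vec Carrier n → Carrier → Vec Carrier n
  v +ᶜ c = map (_+ c) v

  neg : ∀ {n} → Vec Carrier n → Vec Carrier n
  neg = map -_

  neg-involutive : ∀ {n} (a : Vec Carrier n) → neg (neg a) ≡ a
  neg-involutive a = trans (sym (map-∘ -_ -_ a)) (trans (map-cong ⁻¹-involutive a) (map-id a))

  sumF-neg : ∀ {n} (a : Vec Carrier n) → sumF (neg a) ≡ - sumF a
  sumF-neg []      = sym ε⁻¹≈ε
  sumF-neg (c ∷ a) = trans (cong (- c +_) (sumF-neg a)) (⁻¹-∙-comm c (sumF a))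

  sumF-nonneg : ∀ {n} (a : Vec Carrier n) → Nonneg a → 0# ≤ sumF a
  sumF-nonneg []      _   = ≤-refl
  sumF-nonneg (c ∷ a) a≥0 =
    subst (_≤ c + sumF a) (+-identityʳ 0#) (+-mono-≤ (a≥0 Fin.zero) (sumF-nonneg a (a≥0 ∘ Fin.suc)))

  sumF-+ᶜ : ∀ {n} (v : Vec Carrier n) c → sumF (v +ᶜ c) ≡ sumF v + n ×ₙ c
  sumF-+ᶜ []      c = sym (+-identityʳ 0#)
  sumF-+ᶜ (x ∷ v) c = trans (cong (x + c +_) (sumF-+ᶜ v c)) (interchange x c (sumF v) _)

  sumF-shifted : ∀ {m} n (u u′ a : Vec Carrier m) →
    (∀ j → lookup u′ j ≡ lookup u j + n ×ₙ lookup a j) → sumF u′ ≡ sumF u + n ×ₙ sumF a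
  sumF-shifted n []      []        []      _ = trans (sym (+-identityʳ 0#)) (cong (0# +_) (sym (×-zeroʳ n)))
  sumF-shifted n (x ∷ u) (x′ ∷ u′) (c ∷ a) h = begin
    x′ + sumF u′                            ≡⟨ cong₂ _+_ (h Fin.zero) (sumF-shifted n u u′ a (h ∘ Fin.suc)) ⟩
    (x + n ×ₙ c) + (sumF u + n ×ₙ sumF a)   ≡⟨ interchange x _ (sumF u) _ ⟩
    (x + sumF u) + (n ×ₙ c + n ×ₙ sumF a)   ≡⟨ cong (x + sumF u +_) (×-distrib-+ c (sumF a) n) ⟨
    (x + sumF u) + n ×ₙ (c + sumF a)        ∎
    where open ≡-Reasoning

  sumOver-+ᶜ : ∀ {r d} (I : Vec (Fin r) d) (v : Vec Carrier r) c → sumOver I (v +ᶜ c) ≡ sumOver I v + d ×ₙ c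
  sumOver-+ᶜ {d = d} I v c = begin
    sumF (map (lookup (v +ᶜ c)) I)     ≡⟨ cong sumF (map-cong (λ i → lookup-map i (_+ c) v) I) ⟩
    sumF (map ((_+ c) ∘ lookup v) I)   ≡⟨ cong sumF (map-∘ (_+ c) (lookup v) I) ⟩
    sumF (map (lookup v) I +ᶜ c)       ≡⟨ sumF-+ᶜ (map (lookup v) I) c ⟩
    sumOver I v + d ×ₙ c               ∎
    where open ≡-Reasoning

  Decreasing-+ᶜ : ∀ {n} (v : Vec Carrier n) c → Decreasing v → Decreasing (v +ᶜ c)
  Decreasing-+ᶜ v c dec i j i≤j =
    subst₂ _≤_ (sym (lookup-map j (_+ c) v)) (sym (lookup-map i (_+ c) v)) (+-monoˡ-≤ c (dec i j i≤j))

  entry : ∀ {m r} → Point m r → Fin m → Fin r → Carrier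
  entry x j i = lookup (lookup (proj₁ x) j) i

  entryν : ∀ {m r} → Point m r → Fin r → Carrier
  entryν x i = lookup (proj₂ x) i

  Point-ext : ∀ {m r} {x y : Point m r} →
    (∀ j i → entry x j i ≡ entry y j i) → (∀ i → entryν x i ≡ entryν y i) → x ≡ y
  Point-ext hλ hν = cong₂ _,_ (vec-ext λ j → vec-ext (hλ j)) (vec-ext hν)

  entry-⊕ : ∀ {m r} (x y : Point m r) j i → entry (x ⊕ y) j i ≡ entry x j i + entry y j i
  entry-⊕ (λs , _) (λs′ , _) j i =
    trans (cong (λ v → lookup v i) (lookup-zipWith (zipWith _+_) j λs λs′))
      (lookup-zipWith _+_ i (lookup λs j) (lookup λs′ j))

  entryν-⊕ : ∀ {m r} (x y : Point m r) i → entryν (x ⊕ y) i ≡ entryν x i + entryν y i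
  entryν-⊕ (_ , ν) (_ , ν′) i = lookup-zipWith _+_ i ν ν′

  shift : ∀ {m r} → Point m r → Vec Carrier m → Point m r
  shift (λs , ν) a = zipWith _+ᶜ_ λs a , ν +ᶜ sumF a

  shift-λ : ∀ {m r} (x : Point m r) a j → lookup (proj₁ (shift x a)) j ≡ lookup (proj₁ x) j +ᶜ lookup a j
  shift-λ (λs , ν) a j = lookup-zipWith _+ᶜ_ j λs a

  entry-shift : ∀ {m r} (x : Point m r) a j i → entry (shift x a) j i ≡ entry x j i + lookup a j
  entry-shift x a j i = trans (cong (λ v → lookup v i) (shift-λ x a j)) (lookup-map i _ (lookup (proj₁ x) j))

  entryν-shift : ∀ {m r} (x : Point m r) a i → entryν (shift x a) i ≡ entryν x i + sumF a
  entryν-shift (_ , ν) a i = lookup-map i _ ν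

  shift-shift-neg : ∀ {m r} (x : Point m r) a → shift (shift x a) (neg a) ≡ x
  shift-shift-neg x a = Point-ext λ-entry ν-entry
    where
    open ≡-Reasoning
    λ-entry : ∀ j i → entry (shift (shift x a) (neg a)) j i ≡ entry x j i
    λ-entry j i = begin
      entry (shift (shift x a) (neg a)) j i     ≡⟨ entry-shift (shift x a) (neg a) j i ⟩
      entry (shift x a) j i + lookup (neg a) j  ≡⟨ cong₂ _+_ (entry-shift x a j i) (lookup-map j -_ a) ⟩
      (entry x j i + lookup a j) + - lookup a j ≡⟨ //-rightDividesʳ (lookup a j) _ ⟩
      entry x j i                               ∎
    ν-entry : ∀ i → entryν (shift (shift x a) (neg a)) i ≡ entryν x i
    ν-entry i = begin
      entryν (shift (shift x a) (neg a)) i  ≡⟨ entryν-shift (shift x a) (neg a) i ⟩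
      entryν (shift x a) i + sumF (neg a)   ≡⟨ cong₂ _+_ (entryν-shift x a i) (sumF-neg a) ⟩
      (entryν x i + sumF a) + - sumF a      ≡⟨ //-rightDividesʳ (sumF a) _ ⟩
      entryν x i                            ∎

  shift-neg-shift : ∀ {m r} (x : Point m r) a → shift (shift x (neg a)) a ≡ x
  shift-neg-shift x a = subst (λ b → shift (shift x (neg a)) b ≡ x) (neg-involutive a) (shift-shift-neg x (neg a))

  shift-injective : ∀ {m r} {z z′ : Point m r} a → shift z a ≡ shift z′ a → z ≡ z′
  shift-injective {z = z} {z′} a e = begin
    z                          ≡⟨ shift-shift-neg z a ⟨
    shift (shift z a) (neg a)  ≡⟨ cong (λ y → shift y (neg a)) e ⟩
    shift (shift z′ a) (neg a) ≡⟨ shift-shift-neg z′ a ⟩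
    z′                         ∎
    where open ≡-Reasoning

  δ : ∀ {m} → Fin m → Fin m → Carrier
  δ k j = if does (k Fin.≟ j) then 1# else 0#

  sumF-*0 : ∀ {m} (a : Vec Carrier m) → sumF (tabulate (λ j → lookup a j * 0#)) ≡ 0#
  sumF-*0 []      = refl
  sumF-*0 (c ∷ a) = trans (cong₂ _+_ (zeroʳ c) (sumF-*0 a)) (+-identityʳ 0#)

  -- The suc clause relies on does (suc k ≟ suc j) computing to does (k ≟ j).
  sumF-*δ : ∀ {m} (a : Vec Carrier m) k → sumF (tabulate (λ j → lookup a j * δ k j)) ≡ lookup a k
  sumF-*δ (c ∷ a) Fin.zero    = trans (cong₂ _+_ (*-identityʳ c) (sumF-*0 a)) (+-identityʳ c)
  sumF-*δ (c ∷ a) (Fin.suc k) = trans (cong₂ _+_ (zeroʳ c) (sumF-*δ a k)) (+-identityˡ (lookup a k))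

  entry-foldr-⊕ : ∀ {n m r} (ps : Vec (Point m r) n) k i →
    entry (foldr _ _⊕_ zeroP ps) k i ≡ sumF (map (λ p → entry p k i) ps)
  entry-foldr-⊕ {r = r} []       k i =
    trans (cong (λ v → lookup v i) (lookup-replicate k (replicate r 0#))) (lookup-replicate i 0#)
  entry-foldr-⊕         (p ∷ ps) k i =
    trans (entry-⊕ p (foldr _ _⊕_ zeroP ps) k i) (cong (entry p k i +_) (entry-foldr-⊕ ps k i))

  entryν-foldr-⊕ : ∀ {n m r} (ps : Vec (Point m r) n) i →
    entryν (foldr _ _⊕_ zeroP ps) i ≡ sumF (map (λ p → entryν p i) ps)
  entryν-foldr-⊕ []       i = lookup-replicate i 0#
  entryν-foldr-⊕ (p ∷ ps) i = trans (entryν-⊕ p (foldr _ _⊕_ zeroP ps) i) (cong (entryν p i +_) (entryν-foldr-⊕ ps i))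

  lookup-indicator : ∀ {r} b (i : Fin r) → lookup (if b then ω r else replicate r 0#) i ≡ (if b then 1# else 0#)
  lookup-indicator true  i = lookup-replicate i 1#
  lookup-indicator false i = lookup-replicate i 0#

  entry-·xgen : ∀ {m} r c (j k : Fin m) i → entry (c · xgen r j) k i ≡ c * δ k j
  entry-·xgen r c j k i = begin
    lookup (lookup (map (map (c *_)) (tabulate block)) k) i ≡⟨ cong (λ v → lookup v i) (lookup-map k _ (tabulate block)) ⟩
    lookup (map (c *_) (lookup (tabulate block) k)) i       ≡⟨ lookup-map i _ (lookup (tabulate block) k) ⟩
    c * lookup (lookup (tabulate block) k) i                ≡⟨ cong (λ v → c * lookup v i) (lookup∘tabulate block k) ⟩
    c * lookup (block k) i                                  ≡⟨ cong (c *_) (lookup-indicator (does (k Fin.≟ j)) i) ⟩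
    c * δ k j                                               ∎
    where
    open ≡-Reasoning
    block : Fin _ → Vec Carrier r
    block k′ = if does (k′ Fin.≟ j) then ω r else replicate r 0#

  entryν-·xgen : ∀ {m} r c (j : Fin m) i → entryν (c · xgen r j) i ≡ c
  entryν-·xgen r c j i = trans (lookup-map i _ (ω r)) (trans (cong (c *_) (lookup-replicate i 1#)) (*-identityʳ c))

  entry-comb : ∀ {m} r (a : Vec Carrier m) k i → entry (comb r a) k i ≡ lookup a k
  entry-comb r a k i = begin
    entry (comb r a) k i                            ≡⟨ entry-foldr-⊕ (tabulate term) k i ⟩
    sumF (map (λ p → entry p k i) (tabulate term))  ≡⟨ cong sumF (tabulate-∘ _ term) ⟨
    sumF (tabulate (λ j → entry (term j) k i))      ≡⟨ cong sumF (tabulate-cong λ j → entry-·xgen r (lookup a j) j k i) ⟩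
    sumF (tabulate (λ j → lookup a j * δ k j))      ≡⟨ sumF-*δ a k ⟩
    lookup a k                                      ∎
    where
    open ≡-Reasoning
    term : Fin _ → Point _ r
    term j = lookup a j · xgen r j

  entryν-comb : ∀ {m} r (a : Vec Carrier m) i → entryν (comb r a) i ≡ sumF a
  entryν-comb r a i = begin
    entryν (comb r a) i                            ≡⟨ entryν-foldr-⊕ (tabulate term) i ⟩
    sumF (map (λ p → entryν p i) (tabulate term))  ≡⟨ cong sumF (tabulate-∘ _ term) ⟨
    sumF (tabulate (λ j → entryν (term j) i))      ≡⟨ cong sumF (tabulate-cong λ j → entryν-·xgen r (lookup a j) j i) ⟩
    sumF (tabulate (lookup a))                     ≡⟨ cong sumF (tabulate∘lookup a) ⟩
    sumF a                                         ∎
    where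
    open ≡-Reasoning
    term : Fin _ → Point _ r
    term j = lookup a j · xgen r j

  ⊕-comb : ∀ {m r} (x : Point m r) a → x ⊕ comb r a ≡ shift x a
  ⊕-comb {r = r} x a = Point-ext
    (λ j i → trans (entry-⊕ x (comb r a) j i) (trans (cong (entry x j i +_) (entry-comb r a j i)) (sym (entry-shift x a j i))))
    (λ i → trans (entryν-⊕ x (comb r a) i) (trans (cong (entryν x i +_) (entryν-comb r a i)) (sym (entryν-shift x a i))))

  module _ {m r} (x : Point m r) (a : Vec Carrier m) where
    private
      λs = proj₁ x
      ν = proj₂ x

    sumF-ν-shift : sumF (proj₂ (shift x a)) ≡ sumF ν + r ×ₙ sumF a
    sumF-ν-shift = sumF-+ᶜ ν (sumF a)

    sumF-λ-shift : sumF (map sumF (proj₁ (shift x a))) ≡ sumF (map sumF λs) + r ×ₙ sumF a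
    sumF-λ-shift = sumF-shifted r (map sumF λs) (map sumF (proj₁ (shift x a))) a λ j → begin
      lookup (map sumF (proj₁ (shift x a))) j   ≡⟨ lookup-map j sumF (proj₁ (shift x a)) ⟩
      sumF (lookup (proj₁ (shift x a)) j)       ≡⟨ cong sumF (shift-λ x a j) ⟩
      sumF (lookup λs j +ᶜ lookup a j)          ≡⟨ sumF-+ᶜ (lookup λs j) (lookup a j) ⟩
      sumF (lookup λs j) + r ×ₙ lookup a j      ≡⟨ cong (_+ _) (lookup-map j sumF λs) ⟨
      lookup (map sumF λs) j + r ×ₙ lookup a j  ∎
      where open ≡-Reasoning

    sumOver-ν-shift : ∀ {d} (K : Vec (Fin r) d) → sumOver K (proj₂ (shift x a)) ≡ sumOver K ν + d ×ₙ sumF a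
    sumOver-ν-shift K = sumOver-+ᶜ K ν (sumF a)

    sumOver-λ-shift : ∀ {d} (Is : Vec (Vec (Fin r) d) m) →
      sumF (zipWith sumOver Is (proj₁ (shift x a))) ≡ sumF (zipWith sumOver Is λs) + d ×ₙ sumF a
    sumOver-λ-shift {d} Is = sumF-shifted d (zipWith sumOver Is λs) (zipWith sumOver Is (proj₁ (shift x a))) a λ j → begin
      lookup (zipWith sumOver Is (proj₁ (shift x a))) j   ≡⟨ lookup-zipWith sumOver j Is _ ⟩
      sumOver (lookup Is j) (lookup (proj₁ (shift x a)) j) ≡⟨ cong (sumOver (lookup Is j)) (shift-λ x a j) ⟩
      sumOver (lookup Is j) (lookup λs j +ᶜ lookup a j)    ≡⟨ sumOver-+ᶜ (lookup Is j) (lookup λs j) (lookup a j) ⟩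
      sumOver (lookup Is j) (lookup λs j) + d ×ₙ lookup a j ≡⟨ cong (_+ _) (lookup-zipWith sumOver j Is λs) ⟨
      lookup (zipWith sumOver Is λs) j + d ×ₙ lookup a j   ∎
      where open ≡-Reasoning

    CondI-shift : CondI x → CondI (shift x a)
    CondI-shift (λs-dec , ν-dec) =
      (λ j → subst Decreasing (sym (shift-λ x a j)) (Decreasing-+ᶜ (lookup λs j) (lookup a j) (λs-dec j))) ,
      Decreasing-+ᶜ ν (sumF a) ν-dec

    CondII-shift : CondII x → CondII (shift x a)
    CondII-shift |λ|≡|ν| =
      trans sumF-λ-shift (trans (cong (_+ r ×ₙ sumF a) |λ|≡|ν|) (sym sumF-ν-shift))

    CondII′-shift : CondII' x → CondII' (shift x a)
    CondII′-shift |ν|≤|λ| =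
      subst₂ _≤_ (sym sumF-ν-shift) (sym sumF-λ-shift) (+-monoˡ-≤ (r ×ₙ sumF a) |ν|≤|λ|)

    Horn-shift : Horn x → Horn (shift x a)
    Horn-shift horn d 1≤d d<r Is K Is-inc K-inc c≡1 =
      subst₂ _≤_ (sym (sumOver-ν-shift K)) (sym (sumOver-λ-shift Is))
        (+-monoˡ-≤ (d ×ₙ sumF a) (horn d 1≤d d<r Is K Is-inc K-inc c≡1))

    C-shift : C x → C (shift x a)
    C-shift (i , ii , iii) = CondI-shift i , CondII-shift ii , Horn-shift iii

    EqC-shift : EqC x → EqC (shift x a)
    EqC-shift (i , ii′ , iii) = CondI-shift i , CondII′-shift ii′ , Horn-shift iii

  LastEntry⁺ : ∀ {n} (P : Carrier → Set ℓ) (v : Vec Carrier (suc n)) → P (lookup v (fromℕ n)) → LastEntry P v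
  LastEntry⁺ {n} P v p i 1+i≡1+n = subst (P ∘ lookup v) (sym i≡last) p
    where
    i≡last : i ≡ fromℕ n
    i≡last = toℕ-injective (trans (suc-injective 1+i≡1+n) (sym (toℕ-fromℕ n)))

  LastEntry⁻ : ∀ {n} (P : Carrier → Set ℓ) (v : Vec Carrier (suc n)) → LastEntry P v → P (lookup v (fromℕ n))
  LastEntry⁻ {n} P v h = h (fromℕ n) (cong suc (toℕ-fromℕ n))

  lastParts : ∀ {m n} → Point m (suc n) → Vec Carrier m
  lastParts {n = n} (λs , _) = map (λ l → lookup l (fromℕ n)) λs

  lookup-lastParts : ∀ {m n} (x : Point m (suc n)) j → lookup (lastParts x) j ≡ entry x j (fromℕ n)
  lookup-lastParts (λs , _) j = lookup-map j _ λs

  dropLast : ∀ {m n} → Point m (suc n) → Point m (suc n)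
  dropLast x = shift x (neg (lastParts x))

  dropLast⊕comb-lastParts : ∀ {m n} (x : Point m (suc n)) → dropLast x ⊕ comb (suc n) (lastParts x) ≡ x
  dropLast⊕comb-lastParts x = trans (⊕-comb (dropLast x) (lastParts x)) (shift-neg-shift x (lastParts x))

  LastZero-dropLast : ∀ {m n} (x : Point m (suc n)) → LastZero (dropLast x)
  LastZero-dropLast {n = n} x j = LastEntry⁺ (_≡ 0#) (lookup (proj₁ (dropLast x)) j) (begin
    entry (dropLast x) j (fromℕ n)                      ≡⟨ entry-shift x _ j (fromℕ n) ⟩
    entry x j (fromℕ n) + lookup (neg (lastParts x)) j  ≡⟨ cong (_ +_) (lookup-map j -_ (lastParts x)) ⟩
    entry x j (fromℕ n) + - lookup (lastParts x) j      ≡⟨ cong (λ t → entry x j (fromℕ n) + - t) (lookup-lastParts x j) ⟩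
    entry x j (fromℕ n) + - entry x j (fromℕ n)         ≡⟨ -‿inverseʳ _ ⟩
    0#                                                  ∎)
    where open ≡-Reasoning

  lastParts-shift : ∀ {m n} (z : Point m (suc n)) a → LastZero z → lastParts (shift z a) ≡ a
  lastParts-shift {n = n} z a last≡0 = vec-ext λ j → begin
    lookup (lastParts (shift z a)) j  ≡⟨ lookup-lastParts (shift z a) j ⟩
    entry (shift z a) j (fromℕ n)     ≡⟨ entry-shift z a j (fromℕ n) ⟩
    entry z j (fromℕ n) + lookup a j  ≡⟨ cong (_+ lookup a j) (LastEntry⁻ (_≡ 0#) (lookup (proj₁ z) j) (last≡0 j)) ⟩
    0# + lookup a j                   ≡⟨ +-identityˡ _ ⟩
    lookup a j                        ∎
    where open ≡-Reasoning

  Nonneg-lastParts : ∀ {m n} (x : Point m (suc n)) → LastNonneg x → Nonneg (lastParts x)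
  Nonneg-lastParts x last≥0 j =
    subst (0# ≤_) (sym (lookup-lastParts x j)) (LastEntry⁻ (0# ≤_) (lookup (proj₁ x) j) (last≥0 j))

  LastNonneg-shift : ∀ {m r} (z : Point m r) a → LastZero z → Nonneg a → LastNonneg (shift z a)
  LastNonneg-shift z a last≡0 a≥0 j i i-last =
    subst (0# ≤_) (sym (trans (entry-shift z a j i) (trans (cong (_+ _) (last≡0 j i i-last)) (+-identityˡ _)))) (a≥0 j)

  LastZero⇒LastNonneg : ∀ {m r} (x : Point m r) → LastZero x → LastNonneg x
  LastZero⇒LastNonneg x last≡0 j i i-last = subst (0# ≤_) (sym (last≡0 j i i-last)) ≤-refl

  ⊕comb-injective : ∀ {m n} {z z′ : Point m (suc n)} {a a′} → LastZero z → LastZero z′ →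
    z ⊕ comb (suc n) a ≡ z′ ⊕ comb (suc n) a′ → z ≡ z′ × a ≡ a′
  ⊕comb-injective {z = z} {z′} {a} {a′} last≡0 last≡0′ e = shift-injective a shifts≡ , a≡a′
    where
    shifts≡′ : shift z a ≡ shift z′ a′
    shifts≡′ = trans (sym (⊕-comb z a)) (trans e (⊕-comb z′ a′))
    a≡a′ : a ≡ a′
    a≡a′ = trans (sym (lastParts-shift z a last≡0)) (trans (cong lastParts shifts≡′) (lastParts-shift z′ a′ last≡0′))
    shifts≡ : shift z a ≡ shift z′ a
    shifts≡ = subst (λ b → shift z a ≡ shift z′ b) (sym a≡a′) shifts≡′

  C-⊕comb : ∀ {m r} (y : Point m r) a → C y → C (y ⊕ comb r a)
  C-⊕comb y a cy = subst C (sym (⊕-comb y a)) (C-shift y a cy)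

  EqC-⊕comb : ∀ {m r} (y : Point m r) a → EqC y → EqC (y ⊕ comb r a)
  EqC-⊕comb y a eqc = subst EqC (sym (⊕-comb y a)) (EqC-shift y a eqc)

  C-SL-dropLast : ∀ {m n} (x : Point m (suc n)) → C x → C-SL (dropLast x)
  C-SL-dropLast x cx = C-shift x _ cx , LastZero-dropLast x

  LR-dropLast : ∀ {m n} (x : Point m (suc n)) → C x → LR (dropLast x)
  LR-dropLast x cx = C-shift x _ cx , LastZero⇒LastNonneg (dropLast x) (LastZero-dropLast x)

  LR-⊕comb : ∀ {m r} (z : Point m r) a → C-SL z → Nonneg a → LR (z ⊕ comb r a)
  LR-⊕comb z a (cz , last≡0) a≥0 =
    C-⊕comb z a cz , subst LastNonneg (sym (⊕-comb z a)) (LastNonneg-shift z a last≡0 a≥0)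

  EqC⇒EqLR-shift : ∀ {k r} (x : Point (suc (suc k)) r) → EqC x → Σ (Vec Carrier (suc (suc k))) λ b → EqLR (shift x b)
  EqC⇒EqLR-shift {k} x eqc = b , EqC-shift x b eqc , last≥0 , λ⊆ν
    where
    bounded : Σ Carrier λ M → 0# ≤ M × (∀ j i → (entry x j i + - entryν x i) ⊔ (- entry x j i) ≤ M)
    bounded = upper-bound₂ (λ j i → (entry x j i + - entryν x i) ⊔ (- entry x j i))
    M : Carrier
    M = proj₁ bounded
    b : Vec Carrier (suc (suc k))
    b = replicate (suc (suc k)) M
    λ-ν≤M : ∀ j i → entry x j i + - entryν x i ≤ M
    λ-ν≤M j i = ≤-trans (x≤x⊔y _ _) (proj₂ (proj₂ bounded) j i)
    -λ≤M : ∀ j i → - entry x j i ≤ M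
    -λ≤M j i = ≤-trans (x≤y⊔x _ _) (proj₂ (proj₂ bounded) j i)
    rest≥0 : Nonneg (replicate k M)
    rest≥0 j = subst (0# ≤_) (sym (lookup-replicate j M)) (proj₁ (proj₂ bounded))
    shifted-entry : ∀ j i → entry (shift x b) j i ≡ entry x j i + M
    shifted-entry j i = trans (entry-shift x b j i) (cong (entry x j i +_) (lookup-replicate j M))
    last≥0 : LastNonneg (shift x b)
    last≥0 j i _ = subst (0# ≤_) (sym (shifted-entry j i)) (-x≤y⇒0≤x+y (-λ≤M j i))
    λ⊆ν : CondIV (shift x b)
    λ⊆ν j i = subst₂ _≤_ (sym (shifted-entry j i)) (sym (entryν-shift x b i)) (begin
      entry x j i + M          ≤⟨ +-monoˡ-≤ M (x-y≤z⇒x≤z+y (λ-ν≤M j i)) ⟩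
      (M + entryν x i) + M     ≡⟨ cong (_+ M) (+-comm M (entryν x i)) ⟩
      (entryν x i + M) + M     ≡⟨ +-assoc (entryν x i) M M ⟩
      entryν x i + (M + M)     ≤⟨ +-monoʳ-≤ (entryν x i) (+-monoʳ-≤ M (x≤x+y M (sumF-nonneg (replicate k M) rest≥0))) ⟩
      entryν x i + sumF b      ∎)
      where open PartialOrderReasoning poset

  EqC⇒EqLR⊕comb : ∀ {k r} (x : Point (suc (suc k)) r) → EqC x →
    Σ (Point (suc (suc k)) r) λ y → Σ (Vec Carrier (suc (suc k))) λ a → EqLR y × x ≡ y ⊕ comb r a
  EqC⇒EqLR⊕comb x eqc with EqC⇒EqLR-shift x eqc
  ... | b , eqlr = shift x b , neg b , eqlr , sym (trans (⊕-comb (shift x b) (neg b)) (shift-shift-neg x b))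

open import Data.Nat using (_≤_; _∸_)

proposition3p1 : ∀ {ℓ : Level} (F : OrderedField ℓ) (r s : ℕ) → 1 ≤ r → 3 ≤ s →
    let open OrderedField F using (Carrier)
        open Cones F
        m = s ∸ 1
    in
    -- (1) LR = C_SL ⊕ ⨁_j ℝ≥0 x_j  (internal direct sum)
    ( (∀ (x : Point m r) → LR x →
         Σ (Point m r) λ z → Σ (Vec Carrier m) λ a →
           C-SL z × Nonneg a × x ≡ z ⊕ comb r a)
    × (∀ (z z' : Point m r) (a a' : Vec Carrier m) →
         C-SL z → Nonneg a → C-SL z' → Nonneg a' →
         z ⊕ comb r a ≡ z' ⊕ comb r a' → z ≡ z' × a ≡ a')
    × (∀ (z : Point m r) (a : Vec Carrier m) →
         C-SL z → Nonneg a → LR (z ⊕ comb r a)) )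
    -- (2) C = LR + ⨁_j ℝ x_j
    × (∀ (x : Point m r) →
         (C x → Σ (Point m r) λ y → Σ (Vec Carrier m) λ a → LR y × x ≡ y ⊕ comb r a)
       × ((Σ (Point m r) λ y → Σ (Vec Carrier m) λ a → LR y × x ≡ y ⊕ comb r a) → C x))
    -- (3) EqC = EqLR + ⨁_j ℝ x_j
    × (∀ (x : Point m r) →
         (EqC x → Σ (Point m r) λ y → Σ (Vec Carrier m) λ a → EqLR y × x ≡ y ⊕ comb r a)
       × ((Σ (Point m r) λ y → Σ (Vec Carrier m) λ a → EqLR y × x ≡ y ⊕ comb r a) → EqC x))
proposition3p1 F zero _ () _
proposition3p1 F (suc n) zero _ ()
proposition3p1 F (suc n) (suc zero) _ (s≤s ())
proposition3p1 F (suc n) (suc (suc zero)) _ (s≤s (s≤s ()))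
proposition3p1 F (suc n) (suc (suc (suc k))) _ _ =
    ( (λ x (cx , last≥0) →
          dropLast x , lastParts x , C-SL-dropLast x cx , Nonneg-lastParts x last≥0 , sym (dropLast⊕comb-lastParts x))
    , (λ _ _ _ _ (_ , last≡0) _ (_ , last≡0′) _ → ⊕comb-injective last≡0 last≡0′)
    , LR-⊕comb )
  , (λ x → (λ cx → dropLast x , lastParts x , LR-dropLast x cx , sym (dropLast⊕comb-lastParts x))
         , λ { (y , a , (cy , _) , x≡y⊕a) → subst C (sym x≡y⊕a) (C-⊕comb y a cy) })
  , (λ x → EqC⇒EqLR⊕comb x
         , λ { (y , a , (eqc , _) , x≡y⊕a) → subst EqC (sym x≡y⊕a) (EqC-⊕comb y a eqc) })
  where
  open Cones F
  open Shifts F
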